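{- Let $p>3$ be a prime, $t\in \{1,3,p,3p\}$, and $1\leqslant r\leqslant 3p-1$ with $\gcd(r,3p)=1$. Then \[\Lambda(3,r,t)=\begin{cases} \Delta\left(|r|_p\right) & \text{if } r\equiv 1\pmod 3\text{ and }t\in \{3,3p\},\\ \Delta\left(\frac{|r|_p}{\gcd(3,|r|_p)}\right) & \text{if } r\equiv 1\pmod 3\text{ and }t\in \{1,p\},\\ \Delta\left(\frac{|r|_p}{\gcd(2,|r|_p)}\right) & \text{if } r\equiv 2\pmod 3. \end{cases}\]
   Context: $|r|_m$ is the multiplicative order of $r$ modulo $m$. $S_k(x)=1+x+\cdots+x^{k-1}$ for $k\ge1$, $S_0(x)=0$; for a positive integer $m$ with $\gcd(r,m)=1$, $\kappa(m,r,t)=\dfrac{m|r|_m}{\gcd(m,\ tS_{|r|_m}(r))}$. For a divisor $d$ of $3p$, $\Lambda(d,r,t)=\{\ell>0\mid \ell \text{ divides } \frac{|r|_{3p}}{\gcd(\kappa(d,r,t),|r|_{3p})} \text{ and } \gcd(r^{\ell\kappa(d,r,t)}-1,3p)=d\}$. For a positive integer $m$, $\Delta(m)=\{\ell\in\mathbb{Z}\mid 0<\ell<m,\ \ell\mid m\}$. -}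

module Defs where

open import Data.Nat using (ℕ; zero; suc; _+_; _*_; _∸_; _^_; _<_; _≡ᵇ_; _%_; _/_)
open import Data.Nat.Divisibility using (_∣_)
open import Data.Nat.GCD using (gcd)
open import Data.Bool using (if_then_else_)
open import Data.Product using (_×_)
open import Relation.Binary.PropositionalEquality using (_≡_)

-- Total division: a / 0 := 0 (only ever applied to nonzero divisors below).
div : ℕ → ℕ → ℕ
div a zero = 0
div a (suc b) = a / suc b

ordFrom : ℕ → ℕ → ℕ → ℕ → ℕ
ordFrom r m' k zero = 0
ordFrom r m' k (suc f) =
  if ((r ^ k) % suc m') ≡ᵇ (1 % suc m') then k else ordFrom r m' (suc k) f

-- When gcd(r,m)=1 it lies in [1,m], so the search
-- over 1..m finds it.  (Value 0 is a junk value for non-coprime r or m = 0.)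
ord : ℕ → ℕ → ℕ
ord r zero = 0
ord r (suc m') = ordFrom r m' 1 (suc m')

S : ℕ → ℕ → ℕ
S zero x = 0
S (suc k) x = S k x + x ^ k

κ : ℕ → ℕ → ℕ → ℕ
κ m r t = div (m * ord r m) (gcd m (t * S (ord r m) r))

Λ : (p d r t : ℕ) → ℕ → Set
Λ p d r t ℓ =
  0 < ℓ
  × ℓ ∣ div (ord r (3 * p)) (gcd (κ d r t) (ord r (3 * p)))
  × gcd (r ^ (ℓ * κ d r t) ∸ 1) (3 * p) ≡ d

Δ : ℕ → ℕ → Set
Δ m ℓ = 0 < ℓ × ℓ < m × ℓ ∣ m

{-# OPTIONS --safe #-}
-- Write k = κ(3,r,t), o = |r|_3p and oₚ = |r|_p. As |r|_3 divides k, 3 divides every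
-- r^(xk) − 1, so (3 and p being coprime) o ∣ xk ⇔ oₚ ∣ xk. Both o / gcd(k,o) and
-- K = oₚ / gcd(k,oₚ) divide exactly those x with oₚ ∣ xk, hence they are equal, and
-- gcd(r^(ℓk) − 1, 3p) = 3 ⇔ p ∤ r^(ℓk) − 1 ⇔ oₚ ∤ ℓk ⇔ K ∤ ℓ. So Λ(3,r,t) = Δ(K).
-- Finally |r|_3 = 1 or 2 according as r ≡ 1 or 2 (mod 3), and S_1(r) = 1 while
-- 3 ∣ S_2(r) = 1 + r in the second case, which gives k = 1 (3 ∣ t), k = 3 (3 ∤ t), k = 2.
module Submission where

open import Defs
open import Data.Nat using (ℕ; zero; suc; _+_; _*_; _∸_; _<_; _≤_; _%_; _/_; _^_; _≡ᵇ_; z<s; s≤s; NonZero; >-nonZero; ≢-nonZero; ≢-nonZero⁻¹; nonTrivial⇒≢1)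
open import Data.Nat.Properties
open import Data.Nat.Divisibility
open import Data.Nat.DivMod
open import Data.Nat.GCD
open import Data.Nat.LCM using (lcm; lcm-least; gcd*lcm)
open import Data.Nat.Primality using (Prime; prime⇒irreducible; prime⇒nonZero; prime⇒nonTrivial)
open import Data.Nat.Coprimality using (Coprime; coprime-divisor; coprime-/gcd; coprime⇒gcd≡1; prime⇒coprime; 1-coprimeTo) renaming (sym to ⊥-sym)
open import Data.Bool using (true; false)
open import Data.Fin using (toℕ; fromℕ<)
open import Data.Fin.Properties using (pigeonhole; toℕ-fromℕ<; toℕ≤pred[n])
open import Data.Product using (∃-syntax; _×_; _,_; proj₁; proj₂)
open import Data.Product.Function.NonDependent.Propositional using (_×-⇔_)
open import Data.Sum using (_⊎_; inj₁; inj₂; [_,_]′)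
open import Function.Bundles using (_⇔_; mk⇔; Equivalence)
open import Function.Related.TypeIsomorphisms using (¬-cong-⇔)
import Function.Properties.Equivalence as ⇔
open import Function.Related.Propositional using (module EquationalReasoning)
open import Relation.Nullary using (¬_; yes; no; contradiction)
open import Relation.Binary.PropositionalEquality

open Equivalence using (to; from)

%≡%⇒∣∸ : ∀ {a b m} .{{_ : NonZero m}} → a % m ≡ b % m → m ∣ a ∸ b
%≡%⇒∣∸ {a} {b} {m} a≡b = divides (a / m ∸ b / m) (begin
  a ∸ b                                       ≡⟨ cong₂ _∸_ (m≡m%n+[m/n]*n a m) (m≡m%n+[m/n]*n b m) ⟩
  (a % m + a / m * m) ∸ (b % m + b / m * m)   ≡⟨ cong (λ x → (a % m + a / m * m) ∸ (x + b / m * m)) (sym a≡b) ⟩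
  (a % m + a / m * m) ∸ (a % m + b / m * m)   ≡⟨ [m+n]∸[m+o]≡n∸o (a % m) _ _ ⟩
  a / m * m ∸ b / m * m                       ≡⟨ *-distribʳ-∸ m (a / m) (b / m) ⟨
  (a / m ∸ b / m) * m                         ∎)
  where open ≡-Reasoning

∣∸⇒%≡% : ∀ {a b m} .{{_ : NonZero m}} → b ≤ a → m ∣ a ∸ b → a % m ≡ b % m
∣∸⇒%≡% {a} {b} {m} b≤a m∣a∸b = trans (cong (_% m) (sym (m+[n∸m]≡n b≤a))) (%-remove-+ʳ b m∣a∸b)

[m*n]∸1≡m*[n∸1]+[m∸1] : ∀ m n .{{_ : NonZero n}} → m * n ∸ 1 ≡ m * (n ∸ 1) + (m ∸ 1)
[m*n]∸1≡m*[n∸1]+[m∸1] zero    (suc n) = refl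
[m*n]∸1≡m*[n∸1]+[m∸1] (suc m) (suc n) = begin
  n + m * suc n     ≡⟨ cong (n +_) (*-suc m n) ⟩
  n + (m + m * n)   ≡⟨ cong (n +_) (+-comm m (m * n)) ⟩
  n + (m * n + m)   ≡⟨ +-assoc n (m * n) m ⟨
  n + m * n + m     ∎
  where open ≡-Reasoning

module _ {d r : ℕ} .{{_ : NonZero r}} where

  private
    r^[m+n]∸1≡ : ∀ m n → r ^ (m + n) ∸ 1 ≡ r ^ m * (r ^ n ∸ 1) + (r ^ m ∸ 1)
    r^[m+n]∸1≡ m n = trans (cong (_∸ 1) (^-distribˡ-+-* r m n))
                            ([m*n]∸1≡m*[n∸1]+[m∸1] (r ^ m) (r ^ n) {{m^n≢0 r n}})

  ∣r^m∸1∣r^n∸1⇒∣r^[m+n]∸1 : ∀ m n → d ∣ r ^ m ∸ 1 → d ∣ r ^ n ∸ 1 → d ∣ r ^ (m + n) ∸ 1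
  ∣r^m∸1∣r^n∸1⇒∣r^[m+n]∸1 m n d∣r^m∸1 d∣r^n∸1 =
    subst (d ∣_) (sym (r^[m+n]∸1≡ m n)) (∣m∣n⇒∣m+n (∣n⇒∣m*n (r ^ m) d∣r^n∸1) d∣r^m∸1)

  ∣r^[m+n]∸1∣r^n∸1⇒∣r^m∸1 : ∀ m n → d ∣ r ^ (m + n) ∸ 1 → d ∣ r ^ n ∸ 1 → d ∣ r ^ m ∸ 1
  ∣r^[m+n]∸1∣r^n∸1⇒∣r^m∸1 m n d∣r^[m+n]∸1 d∣r^n∸1 =
    ∣m+n∣m⇒∣n (subst (d ∣_) (r^[m+n]∸1≡ m n) d∣r^[m+n]∸1) (∣n⇒∣m*n (r ^ m) d∣r^n∸1)

  ∣r^n∸1⇒∣r^[q*n]∸1 : ∀ q n → d ∣ r ^ n ∸ 1 → d ∣ r ^ (q * n) ∸ 1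
  ∣r^n∸1⇒∣r^[q*n]∸1 zero    n _         = d ∣0
  ∣r^n∸1⇒∣r^[q*n]∸1 (suc q) n d∣r^n∸1 =
    ∣r^m∸1∣r^n∸1⇒∣r^[m+n]∸1 n (q * n) d∣r^n∸1 (∣r^n∸1⇒∣r^[q*n]∸1 q n d∣r^n∸1)

  ∣r^n∸1∣r^y∸1⇒∣r^[y%n]∸1 : ∀ n y .{{_ : NonZero n}} →
    d ∣ r ^ n ∸ 1 → d ∣ r ^ y ∸ 1 → d ∣ r ^ (y % n) ∸ 1
  ∣r^n∸1∣r^y∸1⇒∣r^[y%n]∸1 n y d∣r^n∸1 d∣r^y∸1 = ∣r^[m+n]∸1∣r^n∸1⇒∣r^m∸1 (y % n) (y / n * n)
    (subst (λ e → d ∣ r ^ e ∸ 1) (m≡m%n+[m/n]*n y n) d∣r^y∸1) (∣r^n∸1⇒∣r^[q*n]∸1 (y / n) n d∣r^n∸1)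

coprime-∣ʳ : ∀ {m n o} → Coprime m n → o ∣ n → Coprime m o
coprime-∣ʳ m⊥n o∣n (d∣m , d∣o) = m⊥n (d∣m , ∣-trans d∣o o∣n)

coprime⇒*∣⇔∣×∣ : ∀ {m n a} → Coprime m n → (m * n ∣ a) ⇔ (m ∣ a × n ∣ a)
coprime⇒*∣⇔∣×∣ {m} {n} m⊥n = mk⇔ (λ mn∣a → m*n∣⇒m∣ m n mn∣a , m*n∣⇒n∣ m n mn∣a)
                                   (λ (m∣a , n∣a) → subst (_∣ _) lcm≡m*n (lcm-least m∣a n∣a))
  where
    lcm≡m*n : lcm m n ≡ m * n
    lcm≡m*n = trans (sym (*-identityˡ (lcm m n)))
                    (trans (cong (_* lcm m n) (sym (coprime⇒gcd≡1 m⊥n))) (gcd*lcm m n))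

coprime-divisor-^ : ∀ {d r} n {x} → Coprime d r → d ∣ r ^ n * x → d ∣ x
coprime-divisor-^ {d}         zero    {x} _   d∣1*x       = subst (d ∣_) (+-identityʳ x) d∣1*x
coprime-divisor-^ {d} {r} (suc n) {x} d⊥r d∣r*r^n*x =
  coprime-divisor-^ n d⊥r (coprime-divisor d⊥r (subst (d ∣_) (*-assoc r (r ^ n) x) d∣r*r^n*x))

m∣n⇒gcd[m,n]≡m : ∀ {m n} → m ∣ n → gcd m n ≡ m
m∣n⇒gcd[m,n]≡m {m} {n} m∣n = ∣-antisym (gcd[m,n]∣m m n) (gcd-greatest ∣-refl m∣n)

prime∤⇒coprime : ∀ {p n} → Prime p → ¬ p ∣ n → Coprime p n
prime∤⇒coprime p-prime p∤n (d∣p , d∣n) with prime⇒irreducible p-prime d∣p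
... | inj₁ d≡1 = d≡1
... | inj₂ refl = contradiction d∣n p∤n

gcd[a,q*p]≡q⇔p∤a : ∀ {a q p} .{{_ : NonZero q}} → Prime p → Coprime q p → q ∣ a →
  (gcd a (q * p) ≡ q) ⇔ (¬ p ∣ a)
gcd[a,q*p]≡q⇔p∤a {a} {q} {p} p-prime q⊥p q∣a = mk⇔ ⇒ ⇐
  where
    ⇒ : gcd a (q * p) ≡ q → ¬ p ∣ a
    ⇒ g≡q p∣a = nonTrivial⇒≢1 {{prime⇒nonTrivial p-prime}} (∣1⇒≡1 (*-cancelˡ-∣ q qp∣q*1))
      where
        qp∣q*1 : q * p ∣ q * 1
        qp∣q*1 = subst (q * p ∣_) (trans g≡q (sym (*-identityʳ q)))
                   (gcd-greatest (from (coprime⇒*∣⇔∣×∣ q⊥p) (q∣a , p∣a)) ∣-refl)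

    ⇐ : ¬ p ∣ a → gcd a (q * p) ≡ q
    ⇐ p∤a = ∣-antisym g∣q (gcd-greatest q∣a (m∣m*n p))
      where
        g⊥p : Coprime (gcd a (q * p)) p
        g⊥p = ⊥-sym (coprime-∣ʳ (prime∤⇒coprime p-prime p∤a) (gcd[m,n]∣m a (q * p)))
        g∣q : gcd a (q * p) ∣ q
        g∣q = coprime-divisor g⊥p (subst (gcd a (q * p) ∣_) (*-comm q p) (gcd[m,n]∣n a (q * p)))

div≡/ : ∀ a b .{{_ : NonZero b}} → div a b ≡ a / b
div≡/ a (suc b) = refl

gcd≢0ˡ : ∀ m n .{{_ : NonZero m}} → NonZero (gcd m n)
gcd≢0ˡ m n = ≢-nonZero (gcd[m,n]≢0 m n (inj₁ (≢-nonZero⁻¹ m)))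

gcd≢0ʳ : ∀ m n .{{_ : NonZero n}} → NonZero (gcd m n)
gcd≢0ʳ m n = ≢-nonZero (gcd[m,n]≢0 m n (inj₂ (≢-nonZero⁻¹ n)))

div[o,gcd[k,o]]∣⇔∣*k : ∀ k o .{{_ : NonZero o}} x → (div o (gcd k o) ∣ x) ⇔ (o ∣ x * k)
div[o,gcd[k,o]]∣⇔∣*k k o x = subst (λ d → (d ∣ x) ⇔ (o ∣ x * k)) (sym (div≡/ o g)) (mk⇔ ⇒ ⇐)
  where
    g : ℕ
    g = gcd k o
    instance
      g≢0 : NonZero g
      g≢0 = gcd≢0ʳ k o
    g∣k : g ∣ k
    g∣k = gcd[m,n]∣m k o
    g∣o : g ∣ o
    g∣o = gcd[m,n]∣n k o

    ⇒ : o / g ∣ x → o ∣ x * k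
    ⇒ o/g∣x = ∣-trans (m/n∣o⇒m∣o*n g∣o o/g∣x) (*-monoʳ-∣ x g∣k)

    ⇐ : o ∣ x * k → o / g ∣ x
    ⇐ o∣x*k = coprime-divisor (⊥-sym (coprime-/gcd k o))
      (subst (o / g ∣_) (*-comm x (k / g)) (m∣n*o⇒m/n∣o g∣o (subst (o ∣_) x*k≡ o∣x*k)))
      where
        x*k≡ : x * k ≡ x * (k / g) * g
        x*k≡ = trans (cong (x *_) (sym (m/n*n≡m g∣k))) (sym (*-assoc x (k / g) g))

Δ⇔∣∧∤ : ∀ {n ℓ} .{{_ : NonZero n}} → Δ n ℓ ⇔ (0 < ℓ × ℓ ∣ n × ¬ n ∣ ℓ)
Δ⇔∣∧∤ {n} {ℓ} = mk⇔
  (λ (0<ℓ , ℓ<n , ℓ∣n) → 0<ℓ , ℓ∣n , λ n∣ℓ → <⇒≱ ℓ<n (∣⇒≤ {{>-nonZero 0<ℓ}} n∣ℓ))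
  (λ (0<ℓ , ℓ∣n , n∤ℓ) → 0<ℓ , ≤∧≢⇒< (∣⇒≤ ℓ∣n) (λ { refl → n∤ℓ ∣-refl }) , ℓ∣n)

module _ {r m′ : ℕ} where

  Hit : ℕ → Set
  Hit i = r ^ i % suc m′ ≡ 1 % suc m′

  IsLeastHitFrom : ℕ → ℕ → Set
  IsLeastHitFrom k o = k ≤ o × Hit o × (∀ {j} → k ≤ j → Hit j → o ≤ j)

  ordFrom-hit : ∀ {k f} → Hit k → ordFrom r m′ k (suc f) ≡ k
  ordFrom-hit {k} hit with r ^ k % suc m′ ≡ᵇ 1 % suc m′ | ≡⇒≡ᵇ (r ^ k % suc m′) (1 % suc m′) hit
  ... | true | _ = refl

  ordFrom-miss : ∀ {k f} → ¬ Hit k → ordFrom r m′ k (suc f) ≡ ordFrom r m′ (suc k) f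
  ordFrom-miss {k} miss with r ^ k % suc m′ ≡ᵇ 1 % suc m′ | ≡ᵇ⇒≡ (r ^ k % suc m′) (1 % suc m′)
  ... | true  | hit = contradiction (hit _) miss
  ... | false | _   = refl

  ordFrom-least : ∀ {k i} f → k ≤ i → i < k + f → Hit i → IsLeastHitFrom k (ordFrom r m′ k f)
  ordFrom-least {k} zero k≤i i<k+0 _ = contradiction (subst (_ <_) (+-identityʳ k) i<k+0) (≤⇒≯ k≤i)
  ordFrom-least {k} {i} (suc f) k≤i i<k+1+f hitᵢ with r ^ k % suc m′ ≟ 1 % suc m′
  ... | yes hitₖ = subst (IsLeastHitFrom k) (sym (ordFrom-hit {k} {f} hitₖ)) (≤-refl , hitₖ , λ k≤j _ → k≤j)
  ... | no missₖ with k<o , hitₒ , least ← ordFrom-least f (≤∧≢⇒< k≤i λ { refl → missₖ hitᵢ })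
                                                          (subst (i <_) (+-suc k f) i<k+1+f) hitᵢ
    = subst (IsLeastHitFrom k) (sym (ordFrom-miss {k} {f} missₖ))
        (<⇒≤ k<o , hitₒ , λ k≤j hitⱼ → least (≤∧≢⇒< k≤j λ { refl → missₖ hitⱼ }) hitⱼ)

coprime∧%≡%⇒∣^[j∸i]∸1 : ∀ {m r i j} .{{_ : NonZero m}} → Coprime m r → i < j →
  r ^ i % m ≡ r ^ j % m → m ∣ r ^ (j ∸ i) ∸ 1
coprime∧%≡%⇒∣^[j∸i]∸1 {m} {r} {i} {j} m⊥r i<j r^i≡r^j =
  coprime-divisor-^ i m⊥r (subst (m ∣_) r^j∸r^i≡ (%≡%⇒∣∸ (sym r^i≡r^j)))
  where
    open ≡-Reasoning
    r^j∸r^i≡ : r ^ j ∸ r ^ i ≡ r ^ i * (r ^ (j ∸ i) ∸ 1)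
    r^j∸r^i≡ = begin
      r ^ j ∸ r ^ i                       ≡⟨ cong (λ e → r ^ e ∸ r ^ i) (m+[n∸m]≡n (<⇒≤ i<j)) ⟨
      r ^ (i + (j ∸ i)) ∸ r ^ i           ≡⟨ cong₂ _∸_ (^-distribˡ-+-* r i (j ∸ i)) (sym (*-identityʳ (r ^ i))) ⟩
      r ^ i * r ^ (j ∸ i) ∸ r ^ i * 1     ≡⟨ *-distribˡ-∸ (r ^ i) (r ^ (j ∸ i)) 1 ⟨
      r ^ i * (r ^ (j ∸ i) ∸ 1)           ∎

∃-exponent : ∀ {r m} .{{_ : NonZero m}} → Coprime r m → ∃[ d ] 0 < d × d ≤ m × m ∣ r ^ d ∸ 1
-- Two of r ^ 0, …, r ^ m are congruent modulo m.
∃-exponent {r} {m} r⊥m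
  with i , j , i<j , rᵢ≡rⱼ ← pigeonhole (n<1+n m) (λ i → fromℕ< (m%n<n (r ^ toℕ i) m))
  = toℕ j ∸ toℕ i , m<n⇒0<n∸m i<j , ≤-trans (m∸n≤m (toℕ j) (toℕ i)) (toℕ≤pred[n] j) ,
    coprime∧%≡%⇒∣^[j∸i]∸1 (⊥-sym r⊥m) i<j
      (trans (sym (toℕ-fromℕ< _)) (trans (cong toℕ rᵢ≡rⱼ) (toℕ-fromℕ< _)))

ord-isLeast : ∀ {r m} .{{_ : NonZero r}} .{{_ : NonZero m}} → Coprime r m →
  0 < ord r m × m ∣ r ^ ord r m ∸ 1 × (∀ {j} → 0 < j → m ∣ r ^ j ∸ 1 → ord r m ≤ j)
ord-isLeast {r} {m@(suc _)} r⊥m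
  with d , 0<d , d≤m , m∣r^d∸1 ← ∃-exponent r⊥m
  with 0<o , hitₒ , least ← ordFrom-least m 0<d (s≤s d≤m) (∣∸⇒%≡% (m^n>0 r d) m∣r^d∸1)
  = 0<o , %≡%⇒∣∸ {r ^ ord r m} {1} hitₒ ,
    λ {j} 0<j m∣r^j∸1 → least 0<j (∣∸⇒%≡% (m^n>0 r j) m∣r^j∸1)

module _ {r m : ℕ} .{{_ : NonZero r}} .{{_ : NonZero m}} (r⊥m : Coprime r m) where

  ord>0 : 0 < ord r m
  ord>0 = proj₁ (ord-isLeast r⊥m)

  ∣r^y∸1⇔ord∣y : ∀ y → (m ∣ r ^ y ∸ 1) ⇔ (ord r m ∣ y)
  ∣r^y∸1⇔ord∣y y = mk⇔ ⇒ ⇐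
    where
      o : ℕ
      o = ord r m
      instance
        o≢0 : NonZero o
        o≢0 = >-nonZero ord>0
      m∣r^o∸1 : m ∣ r ^ o ∸ 1
      m∣r^o∸1 = proj₁ (proj₂ (ord-isLeast r⊥m))
      least : ∀ {j} → 0 < j → m ∣ r ^ j ∸ 1 → o ≤ j
      least = proj₂ (proj₂ (ord-isLeast r⊥m))

      ⇒ : m ∣ r ^ y ∸ 1 → o ∣ y
      ⇒ m∣r^y∸1 with y % o in y%o≡
      ... | zero  = m%n≡0⇒n∣m y o y%o≡
      ... | suc s = contradiction (least z<s m∣r^[1+s]∸1) (<⇒≱ (subst (_< o) y%o≡ (m%n<n y o)))
        where
          m∣r^[1+s]∸1 : m ∣ r ^ suc s ∸ 1
          m∣r^[1+s]∸1 = subst (λ e → m ∣ r ^ e ∸ 1) y%o≡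
                          (∣r^n∸1∣r^y∸1⇒∣r^[y%n]∸1 o y m∣r^o∸1 m∣r^y∸1)

      ⇐ : o ∣ y → m ∣ r ^ y ∸ 1
      ⇐ (divides q refl) = ∣r^n∸1⇒∣r^[q*n]∸1 q o m∣r^o∸1

ord-*-∣⇔ : ∀ {m n r y} .{{_ : NonZero m}} .{{_ : NonZero n}} .{{_ : NonZero r}} →
  Coprime m n → Coprime r (m * n) → m ∣ r ^ y ∸ 1 → (ord r (m * n) ∣ y) ⇔ (ord r n ∣ y)
ord-*-∣⇔ {m} {n} {r} {y} m⊥n r⊥mn m∣r^y∸1 = begin
  ord r (m * n) ∣ y                   ∼⟨ ⇔.sym (∣r^y∸1⇔ord∣y r⊥mn y) ⟩
  m * n ∣ r ^ y ∸ 1                   ∼⟨ coprime⇒*∣⇔∣×∣ m⊥n ⟩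
  (m ∣ r ^ y ∸ 1 × n ∣ r ^ y ∸ 1)     ∼⟨ mk⇔ proj₂ (m∣r^y∸1 ,_) ⟩
  n ∣ r ^ y ∸ 1                       ∼⟨ ∣r^y∸1⇔ord∣y (coprime-∣ʳ r⊥mn (n∣m*n m)) y ⟩
  ord r n ∣ y                         ∎
  where
    open EquationalReasoning
    instance
      mn≢0 : NonZero (m * n)
      mn≢0 = m*n≢0 m n

ord∣κ : ∀ m r t .{{_ : NonZero m}} → ord r m ∣ κ m r t
ord∣κ m r t = subst (o ∣_) (sym (div≡/ (m * o) g)) (m*n∣o⇒m∣o/n o g o*g∣m*o)
  where
    o g : ℕ
    o = ord r m
    g = gcd m (t * S o r)
    instance
      g≢0 : NonZero g
      g≢0 = gcd≢0ˡ m (t * S o r)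
    o*g∣m*o : o * g ∣ m * o
    o*g∣m*o = subst (o * g ∣_) (*-comm o m) (*-monoʳ-∣ o (gcd[m,n]∣m m (t * S o r)))

ord[r,3]≡1 : ∀ {r} → r % 3 ≡ 1 → ord r 3 ≡ 1
ord[r,3]≡1 {r} r≡1 = ordFrom-hit {r} {2} {1} {2} (trans (cong (_% 3) (*-identityʳ r)) r≡1)

ord[r,3]≡2 : ∀ {r} → r % 3 ≡ 2 → ord r 3 ≡ 2
ord[r,3]≡2 {r} r≡2 = trans (ordFrom-miss {r} {2} {1} {2} r^1≢1) (ordFrom-hit {r} {2} {2} {1} r^2≡1)
  where
    r*1≡2 : r * 1 % 3 ≡ 2
    r*1≡2 = trans (cong (_% 3) (*-identityʳ r)) r≡2
    r^1≢1 : r ^ 1 % 3 ≢ 1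
    r^1≢1 r^1≡1 with () ← trans (sym r*1≡2) r^1≡1
    r^2≡1 : r ^ 2 % 3 ≡ 1
    r^2≡1 = trans (%-distribˡ-* r (r * 1) 3) (cong₂ (λ a b → a * b % 3) r≡2 r*1≡2)

κ-ord≡ : ∀ m r t {o} → ord r m ≡ o → κ m r t ≡ div (m * o) (gcd m (t * S o r))
κ-ord≡ m r t = cong (λ o → div (m * o) (gcd m (t * S o r)))

κ[3]≡1 : ∀ {r t} → r % 3 ≡ 1 → 3 ∣ t → κ 3 r t ≡ 1
κ[3]≡1 {r} {t} r≡1 3∣t = trans (κ-ord≡ 3 r t (ord[r,3]≡1 {r} r≡1))
  (cong (div 3) (m∣n⇒gcd[m,n]≡m (∣m⇒∣m*n (S 1 r) 3∣t)))

κ[3]≡3 : ∀ {r t} → r % 3 ≡ 1 → Coprime 3 t → κ 3 r t ≡ 3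
κ[3]≡3 {r} {t} r≡1 3⊥t = trans (κ-ord≡ 3 r t (ord[r,3]≡1 {r} r≡1))
  (cong (div 3) (coprime⇒gcd≡1 (subst (Coprime 3) (sym (*-identityʳ t)) 3⊥t)))

κ[3]≡2 : ∀ {r t} → r % 3 ≡ 2 → κ 3 r t ≡ 2
κ[3]≡2 {r} {t} r≡2 = trans (κ-ord≡ 3 r t (ord[r,3]≡2 {r} r≡2))
  (cong (div 6) (m∣n⇒gcd[m,n]≡m (∣n⇒∣m*n t 3∣S₂[r])))
  where
    3∣S₂[r] : 3 ∣ S 2 r
    3∣S₂[r] = m%n≡0⇒n∣m (S 2 r) 3
      (trans (%-distribˡ-+ 1 (r * 1) 3) (cong (λ x → (1 + x) % 3) (trans (cong (_% 3) (*-identityʳ r)) r≡2)))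

module _ {p : ℕ} (p-prime : Prime p) (3<p : 3 < p) {r : ℕ} .{{_ : NonZero r}} (r⊥3p : Coprime r (3 * p)) where

  Λ[3]⇔Δ : ∀ {t k} → κ 3 r t ≡ k → ∀ ℓ → Λ p 3 r t ℓ ⇔ Δ (div (ord r p) (gcd k (ord r p))) ℓ
  Λ[3]⇔Δ {t} refl ℓ = ⇔.trans (⇔.refl ×-⇔ ℓ∣D⇔ℓ∣K ×-⇔ gcd≡3⇔K∤ℓ) (⇔.sym (Δ⇔∣∧∤ {{K≢0}}))
    where
      open EquationalReasoning
      instance
        p≢0 : NonZero p
        p≢0 = prime⇒nonZero p-prime
        3p≢0 : NonZero (3 * p)
        3p≢0 = m*n≢0 3 p

      3⊥p : Coprime 3 p
      3⊥p = ⊥-sym (prime⇒coprime p-prime 3<p)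
      r⊥p : Coprime r p
      r⊥p = coprime-∣ʳ r⊥3p (n∣m*n 3)

      k o oₚ D K : ℕ
      k  = κ 3 r t
      o  = ord r (3 * p)
      oₚ = ord r p
      D  = div o (gcd k o)
      K  = div oₚ (gcd k oₚ)

      instance
        o≢0 : NonZero o
        o≢0 = >-nonZero (ord>0 r⊥3p)
        oₚ≢0 : NonZero oₚ
        oₚ≢0 = >-nonZero (ord>0 r⊥p)

      3∣r^[x*k]∸1 : ∀ x → 3 ∣ r ^ (x * k) ∸ 1
      3∣r^[x*k]∸1 x = from (∣r^y∸1⇔ord∣y (coprime-∣ʳ r⊥3p (m∣m*n p)) (x * k)) (∣n⇒∣m*n x (ord∣κ 3 r t))

      K∣⇔ : ∀ x → (K ∣ x) ⇔ (oₚ ∣ x * k)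
      K∣⇔ = div[o,gcd[k,o]]∣⇔∣*k k oₚ

      D∣⇔K∣ : ∀ x → (D ∣ x) ⇔ (K ∣ x)
      D∣⇔K∣ x = begin
        D ∣ x       ∼⟨ div[o,gcd[k,o]]∣⇔∣*k k o x ⟩
        o ∣ x * k   ∼⟨ ord-*-∣⇔ 3⊥p r⊥3p (3∣r^[x*k]∸1 x) ⟩
        oₚ ∣ x * k  ∼⟨ ⇔.sym (K∣⇔ x) ⟩
        K ∣ x       ∎

      D≡K : D ≡ K
      D≡K = ∣-antisym (from (D∣⇔K∣ K) ∣-refl) (to (D∣⇔K∣ D) ∣-refl)

      ℓ∣D⇔ℓ∣K : (ℓ ∣ D) ⇔ (ℓ ∣ K)
      ℓ∣D⇔ℓ∣K = subst (λ n → (ℓ ∣ D) ⇔ (ℓ ∣ n)) D≡K ⇔.refl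

      K≢0 : NonZero K
      K≢0 = ≢-nonZero λ K≡0 → ≢-nonZero⁻¹ oₚ (0∣⇒≡0 (subst (_∣ oₚ) K≡0 (from (K∣⇔ oₚ) (m∣m*n k))))

      gcd≡3⇔K∤ℓ : (gcd (r ^ (ℓ * k) ∸ 1) (3 * p) ≡ 3) ⇔ (¬ K ∣ ℓ)
      gcd≡3⇔K∤ℓ = begin
        gcd (r ^ (ℓ * k) ∸ 1) (3 * p) ≡ 3   ∼⟨ gcd[a,q*p]≡q⇔p∤a p-prime 3⊥p (3∣r^[x*k]∸1 ℓ) ⟩
        (¬ p ∣ r ^ (ℓ * k) ∸ 1)             ∼⟨ ¬-cong-⇔ (∣r^y∸1⇔ord∣y r⊥p (ℓ * k)) ⟩
        (¬ oₚ ∣ ℓ * k)                      ∼⟨ ¬-cong-⇔ (⇔.sym (K∣⇔ ℓ)) ⟩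
        (¬ K ∣ ℓ)                           ∎

lemma5p3 : (p : ℕ) → Prime p → 3 < p →
    (t : ℕ) → (t ≡ 1 ⊎ t ≡ 3 ⊎ t ≡ p ⊎ t ≡ 3 * p) →
    (r : ℕ) → 1 ≤ r → r ≤ 3 * p ∸ 1 → Coprime r (3 * p) →
      (r % 3 ≡ 1 → (t ≡ 3 ⊎ t ≡ 3 * p) →
        ∀ ℓ → Λ p 3 r t ℓ ⇔ Δ (ord r p) ℓ)
    × (r % 3 ≡ 1 → (t ≡ 1 ⊎ t ≡ p) →
        ∀ ℓ → Λ p 3 r t ℓ ⇔ Δ (div (ord r p) (gcd 3 (ord r p))) ℓ)
    × (r % 3 ≡ 2 →
        ∀ ℓ → Λ p 3 r t ℓ ⇔ Δ (div (ord r p) (gcd 2 (ord r p))) ℓ)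
lemma5p3 p p-prime 3<p t _ r 0<r _ r⊥3p =
  (λ r≡1 t∈ → subst (λ n → ∀ ℓ → Λ p 3 r t ℓ ⇔ Δ n ℓ) div[oₚ,gcd[1,oₚ]]≡oₚ
                      (Λ[3]⇔Δ′ (κ[3]≡1 {r} {t} r≡1 (3∣t t∈)))) ,
  (λ r≡1 t∈ → Λ[3]⇔Δ′ (κ[3]≡3 {r} {t} r≡1 (3⊥t t∈))) ,
  (λ r≡2    → Λ[3]⇔Δ′ (κ[3]≡2 {r} {t} r≡2))
  where
    instance
      r≢0 : NonZero r
      r≢0 = >-nonZero 0<r

    Λ[3]⇔Δ′ : ∀ {k} → κ 3 r t ≡ k → ∀ ℓ → Λ p 3 r t ℓ ⇔ Δ (div (ord r p) (gcd k (ord r p))) ℓ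
    Λ[3]⇔Δ′ = Λ[3]⇔Δ p-prime 3<p r⊥3p {t}

    div[oₚ,gcd[1,oₚ]]≡oₚ : div (ord r p) (gcd 1 (ord r p)) ≡ ord r p
    div[oₚ,gcd[1,oₚ]]≡oₚ = trans (cong (div (ord r p)) (gcd-zeroˡ (ord r p))) (n/1≡n (ord r p))

    3∣t : t ≡ 3 ⊎ t ≡ 3 * p → 3 ∣ t
    3∣t = [ (λ { refl → ∣-refl }) , (λ { refl → m∣m*n p }) ]′

    3⊥t : t ≡ 1 ⊎ t ≡ p → Coprime 3 t
    3⊥t = [ (λ { refl → ⊥-sym (1-coprimeTo 3) }) , (λ { refl → ⊥-sym (prime⇒coprime p-prime 3<p) }) ]′
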